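{- The characteristic polynomial $a_m(x)=\det(A_m-xI)$ of the adjacency matrix of the graph $G_m$ is given by the recurrence \[ a_m(x) = \begin{cases} 1-x & m=0, \\ x^4-2x^3+x^2-1 & m=1, \\ (-x^3+x^2-x-1)\, a_{m-1}(x) - x^4 a_{m-2}(x) & m \geq 2. \end{cases} \]
   Context: For an integer $m\ge 0$, the transfer graph $G_m$ is the directed graph whose vertices are the pairs $(i,j)$ with $i,j\in\{0,\dots,m\}$ and $j\in\{i-1,i,i+1\}$ (so it has $3m+1$ vertices), with an edge $(i,j)\to(j,k)$ for all such vertices $(i,j),(j,k)$ unless $j=i\pm1$ and $k=i$ (loops allowed). $A_m$ is its $(3m+1)\times(3m+1)$ adjacency matrix, with $(A_m)_{uv}$ the number of edges from $u$ to $v$. -}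

module Defs where

open import Data.Nat as ℕ using (ℕ; zero; suc; _≡ᵇ_)
open import Data.Nat.DivMod using (_/_; _%_)
open import Data.Integer as ℤ using (ℤ; 0ℤ; 1ℤ; -1ℤ)
open import Data.Fin using (Fin; toℕ; punchIn)
open import Data.Bool using (Bool; true; false; if_then_else_; _∧_; _∨_; not)
open import Data.List using (List; []; _∷_; map)
open import Data.Product using (_×_; _,_; proj₁; proj₂)
open import Relation.Binary.PropositionalEquality using (_≡_)

-- Polynomials over ℤ as coefficient lists (constant term first).

Poly : Set
Poly = List ℤ

infixl 6 _+P_
infixl 7 _*P_

_+P_ : Poly → Poly → Poly
[]      +P q       = q
(a ∷ p) +P []      = a ∷ p
(a ∷ p) +P (b ∷ q) = (a ℤ.+ b) ∷ (p +P q)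

scaleP : ℤ → Poly → Poly
scaleP a = map (a ℤ.*_)

_*P_ : Poly → Poly → Poly
[]      *P q = []
(a ∷ p) *P q = scaleP a q +P (0ℤ ∷ (p *P q))

negP : Poly → Poly
negP = map (λ z → ℤ.- z)

constP : ℤ → Poly
constP c = c ∷ []

X : Poly
X = 0ℤ ∷ 1ℤ ∷ []

coeff : Poly → ℕ → ℤ
coeff []      _       = 0ℤ
coeff (a ∷ p) zero    = a
coeff (a ∷ p) (suc n) = coeff p n

infix 4 _≈P_
_≈P_ : Poly → Poly → Set
p ≈P q = ∀ n → coeff p n ≡ coeff q n

sumP : ∀ n → (Fin n → Poly) → Poly
sumP zero    f = []
sumP (suc n) f = f Data.Fin.zero +P sumP n (λ j → f (Data.Fin.suc j))

signP : ℕ → Poly → Poly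
signP zero          p = p
signP (suc zero)    p = negP p
signP (suc (suc k)) p = signP k p

det : ∀ n → (Fin n → Fin n → Poly) → Poly
det zero    M = constP 1ℤ
det (suc n) M =
  sumP (suc n) (λ j → signP (toℕ j)
    (M Data.Fin.zero j *P det n (λ r c → M (Data.Fin.suc r) (punchIn j c))))

-- The transfer graph G_m.
-- Vertices (i,j), 0 ≤ i,j ≤ m, j ∈ {i-1,i,i+1}, enumerated by Fin (3m+1):
--   0 ↦ (0,0);  for t < m:  3t+1 ↦ (t,t+1),  3t+2 ↦ (t+1,t),  3t+3 ↦ (t+1,t+1).

vertex : (m : ℕ) → Fin (suc (3 ℕ.* m)) → ℕ × ℕ
vertex m k with toℕ k
... | zero  = 0 , 0
... | suc k' with k' % 3
...   | 0 = k' / 3 , suc (k' / 3)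
...   | 1 = suc (k' / 3) , k' / 3
...   | _ = suc (k' / 3) , suc (k' / 3)

edge : ℕ × ℕ → ℕ × ℕ → Bool
edge (i , j) (j' , k) =
  (j' ≡ᵇ j) ∧ not (((j ≡ᵇ suc i) ∨ (i ≡ᵇ suc j)) ∧ (k ≡ᵇ i))

A : (m : ℕ) → Fin (suc (3 ℕ.* m)) → Fin (suc (3 ℕ.* m)) → ℤ
A m u v = if edge (vertex m u) (vertex m v) then 1ℤ else 0ℤ

charMatrix : (m : ℕ) → Fin (suc (3 ℕ.* m)) → Fin (suc (3 ℕ.* m)) → Poly
charMatrix m u v =
  if toℕ u ≡ᵇ toℕ v then constP (A m u v) +P negP X else constP (A m u v)

charPoly : ℕ → Poly
charPoly m = det (suc (3 ℕ.* m)) (charMatrix m)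

a₀ : Poly
a₀ = 1ℤ ∷ -1ℤ ∷ []

a₁ : Poly
a₁ = -1ℤ ∷ 0ℤ ∷ 1ℤ ∷ ℤ.- (ℤ.+ 2) ∷ 1ℤ ∷ []

c₁ : Poly
c₁ = -1ℤ ∷ -1ℤ ∷ 1ℤ ∷ -1ℤ ∷ []

x⁴ : Poly
x⁴ = 0ℤ ∷ 0ℤ ∷ 0ℤ ∷ 0ℤ ∷ 1ℤ ∷ []

a : ℕ → Poly
a zero             = a₀
a (suc zero)       = a₁
a (suc (suc m))    = c₁ *P a (suc m) +P negP (x⁴ *P a m)

module Submission where

-- Number the vertices (0,0), (0,1), (1,0), (1,1), (1,2), (2,1), (2,2), … .  Then A_m − xI
-- is the leading (3m+1)-block of a single infinite matrix which is invariant under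
-- shifting rows and columns by 3 and whose entries vanish at distance ≥ 4 from the
-- diagonal.  Expanding a determinant along its top row therefore only ever produces
-- minors whose columns are three chosen ones followed by all columns from s + 3 on,
-- s being the top row.  Following the expansion through one period, the principal
-- minors α_k of size 3k + 4 and a difference δ_k of two other such minors satisfy
--   (α_{k+1}, δ_{k+1}) = T (α_k, δ_k),    T = ( x²(1 − x)      −1     )
--                                             (    x²      −(1 + x)  ),
-- and as tr T = −x³ + x² − x − 1 and det T = x⁴, Cayley–Hamilton for T yields the
-- recurrence of a_m.

open import Defs
open import Level using (0ℓ)
open import Data.Bool using (if_then_else_)
open import Data.Nat using (ℕ; zero; suc; _+_; _*_; _≡ᵇ_; s≤s)
open import Data.Nat.Properties using (+-suc; +-identityʳ; *-comm)
open import Data.Nat.DivMod using (_/_; _%_; m≡m%n+[m/n]*n; m%n<n)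
open import Data.Integer as ℤ using (ℤ; 0ℤ; 1ℤ)
import Data.Integer.Properties as ℤ
open import Data.List using ([]; _∷_)
open import Data.List.Relation.Unary.All using (All; []; _∷_; all?)
open import Data.Maybe using (Maybe; just; nothing)
open import Data.Product using (_×_; _,_; proj₁; proj₂)
open import Data.Fin using (Fin; zero; suc; toℕ; punchIn; punchOut; _≟_)
open import Data.Fin.Properties using (punchIn-punchOut)
open import Function using (_∘_)
open import Relation.Nullary.Decidable using (Dec; True; toWitness; yes; no)
open import Relation.Binary.PropositionalEquality
  using (_≡_; refl; sym; trans; cong; cong₂; isEquivalence; module ≡-Reasoning)
open import Relation.Binary.Structures using (IsEquivalence)
open import Relation.Binary.Bundles using (Setoid)
import Relation.Binary.Reasoning.Setoid as SetoidReasoning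
open import Algebra.Bundles using (CommutativeMonoid; CommutativeRing)
import Algebra.Properties.CommutativeSemigroup as CommutativeSemigroupProperties
import Tactic.RingSolver.Core.AlmostCommutativeRing as ACR
open import Tactic.RingSolver using (solve-∀)

-- Polynomials form a commutative ring

infix 4 _≈_

-- A record rather than _≈P_ itself, so that both polynomials can be inferred from a
-- proof (coeff is not injective).
record _≈_ (p q : Poly) : Set where
  constructor coeffwise
  field coeff-≡ : ∀ n → coeff p n ≡ coeff q n
open _≈_

≈-refl : ∀ {p} → p ≈ p
≈-refl = coeffwise λ _ → refl

≈-reflexive : ∀ {p q} → p ≡ q → p ≈ q
≈-reflexive refl = ≈-refl

≈-sym : ∀ {p q} → p ≈ q → q ≈ p
≈-sym p≈q = coeffwise λ n → sym (coeff-≡ p≈q n)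

≈-trans : ∀ {p q r} → p ≈ q → q ≈ r → p ≈ r
≈-trans p≈q q≈r = coeffwise λ n → trans (coeff-≡ p≈q n) (coeff-≡ q≈r n)

≈-isEquivalence : IsEquivalence _≈_
≈-isEquivalence = record { refl = ≈-refl ; sym = ≈-sym ; trans = ≈-trans }

≈-setoid : Setoid 0ℓ 0ℓ
≈-setoid = record { isEquivalence = ≈-isEquivalence }

module ≈-Reasoning = SetoidReasoning ≈-setoid

0P 1P : Poly
0P = constP 0ℤ
1P = constP 1ℤ

infixl 6 _-P_
_-P_ : Poly → Poly → Poly
p -P q = p +P negP q

shift : Poly → Poly
shift p = 0ℤ ∷ p

∷-cong : ∀ {a b p q} → a ≡ b → p ≈ q → a ∷ p ≈ b ∷ q
∷-cong a≡b p≈q = coeffwise λ { zero → a≡b ; (suc n) → coeff-≡ p≈q n }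

shift-cong : ∀ {p q} → p ≈ q → shift p ≈ shift q
shift-cong = ∷-cong refl

allZero⇒≈[] : ∀ {p} → All (_≡ 0ℤ) p → p ≈ []
allZero⇒≈[] []         = ≈-refl
allZero⇒≈[] (a≡0 ∷ p≡0) = coeffwise λ
  { zero → a≡0 ; (suc n) → coeff-≡ (allZero⇒≈[] p≡0) n }

0P≈[] : 0P ≈ []
0P≈[] = allZero⇒≈[] (refl ∷ [])

coeff-+P : ∀ p q n → coeff (p +P q) n ≡ coeff p n ℤ.+ coeff q n
coeff-+P []      q       n       = sym (ℤ.+-identityˡ _)
coeff-+P (a ∷ p) []      n       = sym (ℤ.+-identityʳ _)
coeff-+P (a ∷ p) (b ∷ q) zero    = refl
coeff-+P (a ∷ p) (b ∷ q) (suc n) = coeff-+P p q n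

coeff-negP : ∀ p n → coeff (negP p) n ≡ ℤ.- coeff p n
coeff-negP []      n       = refl
coeff-negP (a ∷ p) zero    = refl
coeff-negP (a ∷ p) (suc n) = coeff-negP p n

coeff-scaleP : ∀ a p n → coeff (scaleP a p) n ≡ a ℤ.* coeff p n
coeff-scaleP a []      n       = sym (ℤ.*-zeroʳ a)
coeff-scaleP a (b ∷ p) zero    = refl
coeff-scaleP a (b ∷ p) (suc n) = coeff-scaleP a p n

+P-assoc : ∀ p q r → (p +P q) +P r ≡ p +P (q +P r)
+P-assoc []      q       r       = refl
+P-assoc (a ∷ p) []      r       = refl
+P-assoc (a ∷ p) (b ∷ q) []      = refl
+P-assoc (a ∷ p) (b ∷ q) (c ∷ r) = cong₂ _∷_ (ℤ.+-assoc a b c) (+P-assoc p q r)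

+P-comm : ∀ p q → p +P q ≡ q +P p
+P-comm []      []      = refl
+P-comm []      (b ∷ q) = refl
+P-comm (a ∷ p) []      = refl
+P-comm (a ∷ p) (b ∷ q) = cong₂ _∷_ (ℤ.+-comm a b) (+P-comm p q)

+P-identityʳ : ∀ p → p +P [] ≡ p
+P-identityʳ []      = refl
+P-identityʳ (a ∷ p) = refl

+P-commutativeMonoid : CommutativeMonoid 0ℓ 0ℓ
+P-commutativeMonoid = record
  { _≈_ = _≡_ ; _∙_ = _+P_ ; ε = []
  ; isCommutativeMonoid = record
    { isMonoid = record
      { isSemigroup = record
        { isMagma = record { isEquivalence = isEquivalence ; ∙-cong = cong₂ _+P_ }
        ; assoc = +P-assoc }
      ; identity = (λ _ → refl) , +P-identityʳ }
    ; comm = +P-comm } }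

open CommutativeSemigroupProperties (CommutativeMonoid.commutativeSemigroup +P-commutativeMonoid)
  using (interchange; x∙yz≈y∙xz)

+P-cong : ∀ {p p′ q q′} → p ≈ p′ → q ≈ q′ → p +P q ≈ p′ +P q′
+P-cong {p} {p′} {q} {q′} p≈p′ q≈q′ = coeffwise λ n → begin
  coeff (p +P q) n            ≡⟨ coeff-+P p q n ⟩
  coeff p n ℤ.+ coeff q n     ≡⟨ cong₂ ℤ._+_ (coeff-≡ p≈p′ n) (coeff-≡ q≈q′ n) ⟩
  coeff p′ n ℤ.+ coeff q′ n   ≡⟨ coeff-+P p′ q′ n ⟨
  coeff (p′ +P q′) n          ∎
  where open ≡-Reasoning

negP-cong : ∀ {p q} → p ≈ q → negP p ≈ negP q
negP-cong {p} {q} p≈q = coeffwise λ n →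
  trans (coeff-negP p n) (trans (cong ℤ.-_ (coeff-≡ p≈q n)) (sym (coeff-negP q n)))

negP-inverseˡ : ∀ p → negP p +P p ≈ []
negP-inverseˡ p = coeffwise λ n →
  trans (coeff-+P (negP p) p n) (trans (cong (ℤ._+ coeff p n) (coeff-negP p n)) (ℤ.+-inverseˡ (coeff p n)))

negP-inverseʳ : ∀ p → p +P negP p ≈ []
negP-inverseʳ p = ≈-trans (≈-reflexive (+P-comm p (negP p))) (negP-inverseˡ p)

scaleP-cong : ∀ a {p q} → p ≈ q → scaleP a p ≈ scaleP a q
scaleP-cong a {p} {q} p≈q = coeffwise λ n →
  trans (coeff-scaleP a p n) (trans (cong (a ℤ.*_) (coeff-≡ p≈q n)) (sym (coeff-scaleP a q n)))

scaleP-distribʳ : ∀ a b p → scaleP (a ℤ.+ b) p ≡ scaleP a p +P scaleP b p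
scaleP-distribʳ a b []      = refl
scaleP-distribʳ a b (c ∷ p) = cong₂ _∷_ (ℤ.*-distribʳ-+ c a b) (scaleP-distribʳ a b p)

scaleP-distribˡ : ∀ a p q → scaleP a (p +P q) ≡ scaleP a p +P scaleP a q
scaleP-distribˡ a []      q       = refl
scaleP-distribˡ a (b ∷ p) []      = refl
scaleP-distribˡ a (b ∷ p) (c ∷ q) = cong₂ _∷_ (ℤ.*-distribˡ-+ a b c) (scaleP-distribˡ a p q)

scaleP-assoc : ∀ a b p → scaleP a (scaleP b p) ≡ scaleP (a ℤ.* b) p
scaleP-assoc a b []      = refl
scaleP-assoc a b (c ∷ p) = cong₂ _∷_ (sym (ℤ.*-assoc a b c)) (scaleP-assoc a b p)

scaleP-identity : ∀ p → scaleP 1ℤ p ≡ p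
scaleP-identity []      = refl
scaleP-identity (a ∷ p) = cong₂ _∷_ (ℤ.*-identityˡ a) (scaleP-identity p)

scaleP-zero : ∀ p → scaleP 0ℤ p ≈ []
scaleP-zero p = coeffwise (coeff-scaleP 0ℤ p)

*P-congˡ : ∀ p {q q′} → q ≈ q′ → p *P q ≈ p *P q′
*P-congˡ []      q≈q′ = ≈-refl
*P-congˡ (a ∷ p) q≈q′ = +P-cong (scaleP-cong a q≈q′) (shift-cong (*P-congˡ p q≈q′))

*P-zeroʳ : ∀ p → p *P [] ≈ []
*P-zeroʳ []      = ≈-refl
*P-zeroʳ (a ∷ p) = coeffwise λ { zero → refl ; (suc n) → coeff-≡ (*P-zeroʳ p) n }

shift-*P : ∀ p q → shift p *P q ≈ shift (p *P q)
shift-*P p q = +P-cong (scaleP-zero q) ≈-refl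

scaleP-*P : ∀ a p q → scaleP a p *P q ≈ scaleP a (p *P q)
scaleP-*P a []      q = ≈-refl
scaleP-*P a (b ∷ p) q = begin
  scaleP (a ℤ.* b) q +P shift (scaleP a p *P q)      ≈⟨ +P-cong ≈-refl (shift-cong (scaleP-*P a p q)) ⟩
  scaleP (a ℤ.* b) q +P shift (scaleP a (p *P q))    ≈⟨ +P-cong (≈-reflexive (sym (scaleP-assoc a b q)))
                                                                (∷-cong (sym (ℤ.*-zeroʳ a)) ≈-refl) ⟩
  scaleP a (scaleP b q) +P scaleP a (shift (p *P q)) ≡⟨ scaleP-distribˡ a (scaleP b q) (shift (p *P q)) ⟨
  scaleP a (scaleP b q +P shift (p *P q))            ∎
  where open ≈-Reasoning

*P-distribʳ : ∀ p q r → (p +P q) *P r ≈ p *P r +P q *P r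
*P-distribʳ []      q       r = ≈-refl
*P-distribʳ (a ∷ p) []      r = ≈-reflexive (sym (+P-identityʳ _))
*P-distribʳ (a ∷ p) (b ∷ q) r = begin
  scaleP (a ℤ.+ b) r +P shift ((p +P q) *P r)
    ≈⟨ +P-cong ≈-refl (shift-cong (*P-distribʳ p q r)) ⟩
  scaleP (a ℤ.+ b) r +P (shift (p *P r) +P shift (q *P r))
    ≡⟨ cong (_+P (shift (p *P r) +P shift (q *P r))) (scaleP-distribʳ a b r) ⟩
  (scaleP a r +P scaleP b r) +P (shift (p *P r) +P shift (q *P r))
    ≡⟨ interchange (scaleP a r) (scaleP b r) (shift (p *P r)) (shift (q *P r)) ⟩
  (scaleP a r +P shift (p *P r)) +P (scaleP b r +P shift (q *P r)) ∎
  where open ≈-Reasoning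

*P-assoc : ∀ p q r → (p *P q) *P r ≈ p *P (q *P r)
*P-assoc []      q r = ≈-refl
*P-assoc (b ∷ p) q r = begin
  (scaleP b q +P shift (p *P q)) *P r        ≈⟨ *P-distribʳ (scaleP b q) (shift (p *P q)) r ⟩
  scaleP b q *P r +P shift (p *P q) *P r     ≈⟨ +P-cong (scaleP-*P b q r) (shift-*P (p *P q) r) ⟩
  scaleP b (q *P r) +P shift ((p *P q) *P r) ≈⟨ +P-cong ≈-refl (shift-cong (*P-assoc p q r)) ⟩
  scaleP b (q *P r) +P shift (p *P (q *P r)) ∎
  where open ≈-Reasoning

*P-∷ : ∀ p b q → p *P (b ∷ q) ≈ scaleP b p +P shift (p *P q)
*P-∷ []      b q = ≈-sym 0P≈[]
*P-∷ (a ∷ p) b q = ∷-cong (cong (ℤ._+ 0ℤ) (ℤ.*-comm a b)) (begin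
  scaleP a q +P p *P (b ∷ q)                   ≈⟨ +P-cong ≈-refl (*P-∷ p b q) ⟩
  scaleP a q +P (scaleP b p +P shift (p *P q)) ≡⟨ x∙yz≈y∙xz (scaleP a q) (scaleP b p) (shift (p *P q)) ⟩
  scaleP b p +P (scaleP a q +P shift (p *P q)) ∎)
  where open ≈-Reasoning

*P-comm : ∀ p q → p *P q ≈ q *P p
*P-comm p []      = *P-zeroʳ p
*P-comm p (b ∷ q) = ≈-trans (*P-∷ p b q) (+P-cong ≈-refl (shift-cong (*P-comm p q)))

*P-cong : ∀ {p p′ q q′} → p ≈ p′ → q ≈ q′ → p *P q ≈ p′ *P q′
*P-cong {p} {p′} {q} {q′} p≈p′ q≈q′ = begin
  p *P q   ≈⟨ *P-congˡ p q≈q′ ⟩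
  p *P q′  ≈⟨ *P-comm p q′ ⟩
  q′ *P p  ≈⟨ *P-congˡ q′ p≈p′ ⟩
  q′ *P p′ ≈⟨ *P-comm q′ p′ ⟩
  p′ *P q′ ∎
  where open ≈-Reasoning

*P-distribˡ : ∀ p q r → p *P (q +P r) ≈ p *P q +P p *P r
*P-distribˡ p q r = begin
  p *P (q +P r)    ≈⟨ *P-comm p (q +P r) ⟩
  (q +P r) *P p    ≈⟨ *P-distribʳ q r p ⟩
  q *P p +P r *P p ≈⟨ +P-cong (*P-comm q p) (*P-comm r p) ⟩
  p *P q +P p *P r ∎
  where open ≈-Reasoning

*P-identityˡ : ∀ p → 1P *P p ≈ p
*P-identityˡ p = begin
  scaleP 1ℤ p +P 0P ≈⟨ +P-cong ≈-refl 0P≈[] ⟩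
  scaleP 1ℤ p +P [] ≡⟨ +P-identityʳ (scaleP 1ℤ p) ⟩
  scaleP 1ℤ p       ≡⟨ scaleP-identity p ⟩
  p                 ∎
  where open ≈-Reasoning

Poly-commutativeRing : CommutativeRing 0ℓ 0ℓ
Poly-commutativeRing = record
  { Carrier = Poly ; _≈_ = _≈_ ; _+_ = _+P_ ; _*_ = _*P_ ; -_ = negP ; 0# = [] ; 1# = 1P
  ; isCommutativeRing = record
    { isRing = record
      { +-isAbelianGroup = record
        { isGroup = record
          { isMonoid = record
            { isSemigroup = record
              { isMagma = record { isEquivalence = ≈-isEquivalence ; ∙-cong = +P-cong }
              ; assoc = λ p q r → ≈-reflexive (+P-assoc p q r) }
            ; identity = (λ _ → ≈-refl) , (λ p → ≈-reflexive (+P-identityʳ p)) }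
          ; inverse = negP-inverseˡ , negP-inverseʳ
          ; ⁻¹-cong = negP-cong }
        ; comm = λ p q → ≈-reflexive (+P-comm p q) }
      ; *-cong = *P-cong
      ; *-assoc = *P-assoc
      ; *-identity = *P-identityˡ , λ p → ≈-trans (*P-comm p 1P) (*P-identityˡ p)
      ; distrib = *P-distribˡ , λ r p q → *P-distribʳ p q r }
    ; *-comm = *P-comm } }

isZero? : ∀ p → Dec (All (_≡ 0ℤ) p)
isZero? = all? (ℤ._≟ 0ℤ)

Poly-ring : ACR.AlmostCommutativeRing 0ℓ 0ℓ
Poly-ring = ACR.fromCommutativeRing Poly-commutativeRing 0≟
  where
  0≟ : ∀ p → Maybe ([] ≈ p)
  0≟ p with isZero? p
  ... | yes p≡0 = just (≈-sym (allZero⇒≈[] p≡0))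
  ... | no  _   = nothing

-- For closed p and q the hidden argument reduces to ⊤, so p ≈ q is checked by evaluation.
≈-decide : ∀ p q → {True (isZero? (p -P q))} → p ≈ q
≈-decide p q {p-q≡0} = begin
  p                  ≡⟨ +P-identityʳ p ⟨
  p +P []            ≈⟨ +P-cong ≈-refl (negP-inverseˡ q) ⟨
  p +P (negP q +P q) ≡⟨ +P-assoc p (negP q) q ⟨
  (p -P q) +P q      ≈⟨ +P-cong (allZero⇒≈[] (toWitness p-q≡0)) ≈-refl ⟩
  q                  ∎
  where open ≈-Reasoning

-- Determinants

minor : ∀ {n} → (Fin (suc n) → Fin (suc n) → Poly) → Fin (suc n) → Fin n → Fin n → Poly
minor M j r c = M (suc r) (punchIn j c)

sumP-cong : ∀ n {f g : Fin n → Poly} → (∀ j → f j ≈ g j) → sumP n f ≈ sumP n g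
sumP-cong zero    f≈g = ≈-refl
sumP-cong (suc n) f≈g = +P-cong (f≈g zero) (sumP-cong n (f≈g ∘ suc))

sumP-zero : ∀ n {f : Fin n → Poly} → (∀ j → f j ≈ []) → sumP n f ≈ []
sumP-zero zero    f≈0 = ≈-refl
sumP-zero (suc n) f≈0 = +P-cong (f≈0 zero) (sumP-zero n (f≈0 ∘ suc))

signP-cong : ∀ k {p q} → p ≈ q → signP k p ≈ signP k q
signP-cong zero          p≈q = p≈q
signP-cong (suc zero)    p≈q = negP-cong p≈q
signP-cong (suc (suc k)) p≈q = signP-cong k p≈q

signP-zero : ∀ k {p} → p ≈ [] → signP k p ≈ []
signP-zero zero          p≈0 = p≈0
signP-zero (suc zero)    p≈0 = negP-cong p≈0
signP-zero (suc (suc k)) p≈0 = signP-zero k p≈0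

det-cong : ∀ n {M N : Fin n → Fin n → Poly} → (∀ r c → M r c ≈ N r c) → det n M ≈ det n N
det-cong zero    M≈N = ≈-refl
det-cong (suc n) M≈N = sumP-cong (suc n) λ j → signP-cong (toℕ j)
  (*P-cong (M≈N zero j) (det-cong n λ r c → M≈N (suc r) (punchIn j c)))

det-zero-column : ∀ n (M : Fin n → Fin n → Poly) c₀ → (∀ r → M r c₀ ≈ []) → det n M ≈ []
det-zero-column (suc n) M c₀ column≈0 = sumP-zero (suc n) λ j → signP-zero (toℕ j) (term≈0 j)
  where
  term≈0 : ∀ j → M zero j *P det n (minor M j) ≈ []
  term≈0 j with j ≟ c₀
  ... | yes refl = *P-cong (column≈0 zero) ≈-refl
  ... | no j≢c₀  = ≈-trans (*P-congˡ (M zero j) minor≈0) (*P-zeroʳ (M zero j))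
    where
    minor≈0 : det n (minor M j) ≈ []
    minor≈0 = det-zero-column n (minor M j) (punchOut j≢c₀) λ r →
      ≈-trans (≈-reflexive (cong (M (suc r)) (punchIn-punchOut j≢c₀))) (column≈0 (suc r))

-- The transfer graph on all pairs of naturals

translate : ℕ × ℕ → ℕ × ℕ
translate v = suc (proj₁ v) , suc (proj₂ v)

-- The numbering of Defs.vertex, defined so that entry (3 + u) (3 + v) reduces to entry u v.
vert : ℕ → ℕ × ℕ
vert 0                   = 0 , 0
vert 1                   = 0 , 1
vert 2                   = 1 , 0
vert (suc (suc (suc k))) = translate (vert k)

entry : ℕ → ℕ → Poly
entry u v = if u ≡ᵇ v then constP (adjacency u v) +P negP X else constP (adjacency u v)
  where
  adjacency : ℕ → ℕ → ℤ
  adjacency u v = if edge (vert u) (vert v) then 1ℤ else 0ℤ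

vert-1+3q : ∀ q → vert (1 + q * 3) ≡ (q , suc q)
vert-1+3q zero    = refl
vert-1+3q (suc q) = cong translate (vert-1+3q q)

vert-2+3q : ∀ q → vert (2 + q * 3) ≡ (suc q , q)
vert-2+3q zero    = refl
vert-2+3q (suc q) = cong translate (vert-2+3q q)

vert-3+3q : ∀ q → vert (3 + q * 3) ≡ (suc q , suc q)
vert-3+3q zero    = refl
vert-3+3q (suc q) = cong translate (vert-3+3q q)

vertex≡vert : ∀ m k → vertex m k ≡ vert (toℕ k)
vertex≡vert m k with toℕ k
... | zero   = refl
... | suc k′ with k′ % 3 | m≡m%n+[m/n]*n k′ 3 | m%n<n k′ 3
...   | 0                 | k′≡ | _ = trans (sym (vert-1+3q (k′ / 3))) (cong (vert ∘ suc) (sym k′≡))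
...   | 1                 | k′≡ | _ = trans (sym (vert-2+3q (k′ / 3))) (cong (vert ∘ suc) (sym k′≡))
...   | 2                 | k′≡ | _ = trans (sym (vert-3+3q (k′ / 3))) (cong (vert ∘ suc) (sym k′≡))
...   | suc (suc (suc _)) | _   | s≤s (s≤s (s≤s ()))

charMatrix≡entry : ∀ m u v → charMatrix m u v ≡ entry (toℕ u) (toℕ v)
charMatrix≡entry m u v rewrite vertex≡vert m u | vertex≡vert m v = refl

entry-above-band : ∀ u d → entry u (u + (4 + d)) ≡ 0P
entry-above-band 0                   d             = refl
entry-above-band 1                   0             = refl
entry-above-band 1                   1             = refl
entry-above-band 1                   (suc (suc d)) = refl
entry-above-band 2                   d             = refl
entry-above-band (suc (suc (suc u))) d             = entry-above-band u d

entry-below-band : ∀ v d → entry (v + (4 + d)) v ≡ 0P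
entry-below-band 0                   d = refl
entry-below-band 1                   d = refl
entry-below-band 2                   d = refl
entry-below-band (suc (suc (suc v))) d = entry-below-band v d

-- Minors of band form

column : ℕ → ℕ → ℕ → ℕ → ℕ → ℕ
column s u₀ u₁ u₂ 0                   = u₀
column s u₀ u₁ u₂ 1                   = u₁
column s u₀ u₁ u₂ 2                   = u₂
column s u₀ u₁ u₂ (suc (suc (suc c))) = s + (3 + c)

stateMatrix : ℕ → ℕ → ℕ → ℕ → (n : ℕ) → Fin n → Fin n → Poly
stateMatrix s u₀ u₁ u₂ n r c = entry (s + toℕ r) (column s u₀ u₁ u₂ (toℕ c))

column-punchIn₀ : ∀ s u₀ u₁ u₂ {n} (c : Fin (3 + n)) →
  column s u₀ u₁ u₂ (toℕ (punchIn zero c)) ≡ column (suc s) u₁ u₂ (s + 3) (toℕ c)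
column-punchIn₀ s u₀ u₁ u₂ zero                = refl
column-punchIn₀ s u₀ u₁ u₂ (suc zero)          = refl
column-punchIn₀ s u₀ u₁ u₂ (suc (suc zero))    = refl
column-punchIn₀ s u₀ u₁ u₂ (suc (suc (suc c))) = +-suc s (3 + toℕ c)

column-punchIn₁ : ∀ s u₀ u₁ u₂ {n} (c : Fin (3 + n)) →
  column s u₀ u₁ u₂ (toℕ (punchIn (suc zero) c)) ≡ column (suc s) u₀ u₂ (s + 3) (toℕ c)
column-punchIn₁ s u₀ u₁ u₂ zero                = refl
column-punchIn₁ s u₀ u₁ u₂ (suc zero)          = refl
column-punchIn₁ s u₀ u₁ u₂ (suc (suc zero))    = refl
column-punchIn₁ s u₀ u₁ u₂ (suc (suc (suc c))) = +-suc s (3 + toℕ c)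

column-punchIn₂ : ∀ s u₀ u₁ u₂ {n} (c : Fin (3 + n)) →
  column s u₀ u₁ u₂ (toℕ (punchIn (suc (suc zero)) c)) ≡ column (suc s) u₀ u₁ (s + 3) (toℕ c)
column-punchIn₂ s u₀ u₁ u₂ zero                = refl
column-punchIn₂ s u₀ u₁ u₂ (suc zero)          = refl
column-punchIn₂ s u₀ u₁ u₂ (suc (suc zero))    = refl
column-punchIn₂ s u₀ u₁ u₂ (suc (suc (suc c))) = +-suc s (3 + toℕ c)

column-punchIn₃ : ∀ s u₀ u₁ u₂ {n} (c : Fin (3 + n)) →
  column s u₀ u₁ u₂ (toℕ (punchIn (suc (suc (suc zero))) c)) ≡ column (suc s) u₀ u₁ u₂ (toℕ c)
column-punchIn₃ s u₀ u₁ u₂ zero                = refl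
column-punchIn₃ s u₀ u₁ u₂ (suc zero)          = refl
column-punchIn₃ s u₀ u₁ u₂ (suc (suc zero))    = refl
column-punchIn₃ s u₀ u₁ u₂ (suc (suc (suc c))) = +-suc s (3 + toℕ c)

-- state s u₀ u₁ u₂ n is the minor on rows s, …, s + n − 1 and the first n of the columns
-- u₀, u₁, u₂, s + 3, s + 4, … .  It is opaque so that the type checker never unfolds a
-- symbolic determinant while comparing two states.
opaque
  state : ℕ → ℕ → ℕ → ℕ → ℕ → Poly
  state s u₀ u₁ u₂ n = det n (stateMatrix s u₀ u₁ u₂ n)

  state-periodic : ∀ s u₀ u₁ u₂ n →
    state (3 + s) (3 + u₀) (3 + u₁) (3 + u₂) n ≈ state s u₀ u₁ u₂ n
  state-periodic s u₀ u₁ u₂ n = det-cong n λ r c →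
    ≈-reflexive (cong (entry (3 + (s + toℕ r))) (column-periodic (toℕ c)))
    where
    column-periodic : ∀ c → column (3 + s) (3 + u₀) (3 + u₁) (3 + u₂) c ≡ 3 + column s u₀ u₁ u₂ c
    column-periodic 0                   = refl
    column-periodic 1                   = refl
    column-periodic 2                   = refl
    column-periodic (suc (suc (suc c))) = refl

  state-zero-column : ∀ s u₀ u₁ u₂ n → (∀ i → entry (s + i) u₀ ≈ []) →
    state s u₀ u₁ u₂ (suc n) ≈ []
  state-zero-column s u₀ u₁ u₂ n column≈0 =
    det-zero-column (suc n) (stateMatrix s u₀ u₁ u₂ (suc n)) zero (column≈0 ∘ toℕ)

  state-first-column-cong : ∀ s u u′ u₁ u₂ n → (∀ i → entry (s + i) u ≡ entry (s + i) u′) →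
    state s u u₁ u₂ n ≈ state s u′ u₁ u₂ n
  state-first-column-cong s u u′ u₁ u₂ n columns≡ = det-cong n λ r c → ≈-reflexive (same-entry r c)
    where
    same-entry : ∀ {n} (r c : Fin n) → stateMatrix s u u₁ u₂ n r c ≡ stateMatrix s u′ u₁ u₂ n r c
    same-entry r zero                = columns≡ (toℕ r)
    same-entry r (suc zero)          = refl
    same-entry r (suc (suc zero))    = refl
    same-entry r (suc (suc (suc c))) = refl

  minor≈state : ∀ s u₀ u₁ u₂ v₀ v₁ v₂ n (j : Fin (suc n)) →
    (∀ c → column s u₀ u₁ u₂ (toℕ (punchIn j c)) ≡ column (suc s) v₀ v₁ v₂ (toℕ c)) →
    det n (minor (stateMatrix s u₀ u₁ u₂ (suc n)) j) ≈ state (suc s) v₀ v₁ v₂ n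
  minor≈state s u₀ u₁ u₂ v₀ v₁ v₂ n j columns≡ = det-cong n λ r c →
    ≈-reflexive (cong₂ entry (+-suc s (toℕ r)) (columns≡ c))

  state-expand : ∀ s u₀ u₁ u₂ n {S₀ S₁ S₂ S₃} →
    state (suc s) u₁ u₂ (s + 3) (3 + n) ≈ S₀ →
    state (suc s) u₀ u₂ (s + 3) (3 + n) ≈ S₁ →
    state (suc s) u₀ u₁ (s + 3) (3 + n) ≈ S₂ →
    state (suc s) u₀ u₁ u₂ (3 + n) ≈ S₃ →
    state s u₀ u₁ u₂ (4 + n) ≈
      entry s u₀ *P S₀ -P entry s u₁ *P S₁ +P entry s u₂ *P S₂ -P entry s (s + 3) *P S₃
  state-expand s u₀ u₁ u₂ n {S₀} {S₁} {S₂} {S₃} m₀ m₁ m₂ m₃ =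
    ≈-trans (+P-cong (term zero (column-punchIn₀ s u₀ u₁ u₂) m₀)
            (+P-cong (negP-cong (term (suc zero) (column-punchIn₁ s u₀ u₁ u₂) m₁))
            (+P-cong (term (suc (suc zero)) (column-punchIn₂ s u₀ u₁ u₂) m₂)
            (+P-cong (negP-cong (term (suc (suc (suc zero))) (column-punchIn₃ s u₀ u₁ u₂) m₃))
                     beyond-band≈0))))
            (reassociate (entry s u₀ *P S₀) (entry s u₁ *P S₁) (entry s u₂ *P S₂)
                 (entry s (s + 3) *P S₃))
    where
    M : Fin (4 + n) → Fin (4 + n) → Poly
    M = stateMatrix s u₀ u₁ u₂ (4 + n)

    top-row : ∀ c → M zero c ≡ entry s (column s u₀ u₁ u₂ (toℕ c))
    top-row c = cong (λ r → entry r (column s u₀ u₁ u₂ (toℕ c))) (+-identityʳ s)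

    term : ∀ j {v₀ v₁ v₂ S} →
      (∀ c → column s u₀ u₁ u₂ (toℕ (punchIn j c)) ≡ column (suc s) v₀ v₁ v₂ (toℕ c)) →
      state (suc s) v₀ v₁ v₂ (3 + n) ≈ S →
      M zero j *P det (3 + n) (minor M j) ≈ entry s (column s u₀ u₁ u₂ (toℕ j)) *P S
    term j columns≡ minor≈S = *P-cong (≈-reflexive (top-row j))
      (≈-trans (minor≈state s u₀ u₁ u₂ _ _ _ (3 + n) j columns≡) minor≈S)

    beyond-band≈0 : sumP n (λ j → signP (toℕ j) (M zero (suc (suc (suc (suc j)))) *P
                                     det (3 + n) (minor M (suc (suc (suc (suc j))))))) ≈ []
    beyond-band≈0 = sumP-zero n λ j → signP-zero (toℕ j)
      (*P-cong (≈-trans (≈-reflexive (trans (top-row _) (entry-above-band s (toℕ j)))) 0P≈[]) ≈-refl)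

    reassociate : ∀ a b c d → a +P (negP b +P (c +P (negP d +P []))) ≈ a -P b +P c -P d
    reassociate = solve-∀ Poly-ring

-- One period of the expansion

principal : ℕ → ℕ → Poly
principal s = state s s (1 + s) (2 + s)

C E F G H : ℕ → Poly
C = state 4 3 5 6
E = state 5 3 5 7
F = state 5 3 5 6
G = state 3 2 4 5
H = state 3 2 3 5

column4-vanishes : ∀ i → entry (5 + i) 4 ≈ []
column4-vanishes 0                   = 0P≈[]
column4-vanishes 1                   = 0P≈[]
column4-vanishes 2                   = 0P≈[]
column4-vanishes (suc (suc (suc i))) = ≈-trans (≈-reflexive (entry-below-band 4 i)) 0P≈[]

column3-vanishes : ∀ i → entry (6 + i) 3 ≈ []
column3-vanishes 0       = 0P≈[]
column3-vanishes (suc i) = ≈-trans (≈-reflexive (entry-below-band 3 i)) 0P≈[]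

columns2-3-agree : ∀ i → entry (4 + i) 2 ≡ entry (4 + i) 3
columns2-3-agree 0                   = refl
columns2-3-agree 1                   = refl
columns2-3-agree 2                   = refl
columns2-3-agree (suc (suc (suc i))) = trans (entry-below-band 2 (suc i)) (sym (entry-below-band 3 i))

C-column2≈C : ∀ n → state 4 2 5 6 n ≈ C n
C-column2≈C n = state-first-column-cong 4 2 3 5 6 n columns2-3-agree

-- In each step the coefficients on the left of simplify are the top-row entries in the
-- columns u₀, u₁, u₂, s + 3 of the expanded state.

principal₃-step : ∀ n → principal 3 (4 + n) ≈ (1P -P X) *P principal 4 (3 + n) -P C (3 + n)
principal₃-step n = ≈-trans (state-expand 3 3 4 5 n ≈-refl ≈-refl ≈-refl ≈-refl)
  (simplify (principal 4 (3 + n)) (C (3 + n)) (state 4 3 4 6 (3 + n)) (state 4 3 4 5 (3 + n)))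
  where
  simplify : ∀ a b c d → (1P -P X) *P a -P 1P *P b +P 0P *P c -P 0P *P d ≈ (1P -P X) *P a -P b
  simplify = solve-∀ Poly-ring

principal₄-step : ∀ n → principal 4 (4 + n) ≈ negP X *P principal 5 (3 + n)
principal₄-step n = ≈-trans
  (state-expand 4 4 5 6 n ≈-refl ≈-refl (state-zero-column 5 4 5 7 (2 + n) column4-vanishes)
                                        (state-zero-column 5 4 5 6 (2 + n) column4-vanishes))
  (simplify (principal 5 (3 + n)) (state 5 4 6 7 (3 + n)))
  where
  simplify : ∀ a b → (0P -P X) *P a -P 0P *P b +P 1P *P [] -P 1P *P [] ≈ negP X *P a
  simplify = solve-∀ Poly-ring

principal₅-step : ∀ n → principal 5 (4 + n) ≈ negP X *P principal 3 (3 + n)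
principal₅-step n = ≈-trans
  (state-expand 5 5 6 7 n (state-periodic 3 3 4 5 (3 + n)) ≈-refl ≈-refl ≈-refl)
  (simplify (principal 3 (3 + n)) (state 6 5 7 8 (3 + n)) (state 6 5 6 8 (3 + n)) (state 6 5 6 7 (3 + n)))
  where
  simplify : ∀ a b c d → (0P -P X) *P a -P 0P *P b +P 0P *P c -P 0P *P d ≈ negP X *P a
  simplify = solve-∀ Poly-ring

C-step : ∀ n → C (4 + n) ≈ E (3 + n) -P F (3 + n)
C-step n = ≈-trans (state-expand 4 3 5 6 n ≈-refl ≈-refl ≈-refl ≈-refl)
  (simplify (principal 5 (3 + n)) (state 5 3 6 7 (3 + n)) (E (3 + n)) (F (3 + n)))
  where
  simplify : ∀ a b c d → 0P *P a -P 0P *P b +P 1P *P c -P 1P *P d ≈ c -P d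
  simplify = solve-∀ Poly-ring

E-step : ∀ n → E (4 + n) ≈ G (3 + n)
E-step n = ≈-trans
  (state-expand 5 3 5 7 n (state-periodic 3 2 4 5 (3 + n))
                          (state-zero-column 6 3 7 8 (2 + n) column3-vanishes) ≈-refl ≈-refl)
  (simplify (G (3 + n)) (state 6 3 5 8 (3 + n)) (state 6 3 5 7 (3 + n)))
  where
  simplify : ∀ a c d → 1P *P a -P (0P -P X) *P [] +P 0P *P c -P 0P *P d ≈ a
  simplify = solve-∀ Poly-ring

F-step : ∀ n → F (4 + n) ≈ H (3 + n)
F-step n = ≈-trans
  (state-expand 5 3 5 6 n (state-periodic 3 2 3 5 (3 + n))
                          (state-zero-column 6 3 6 8 (2 + n) column3-vanishes) ≈-refl ≈-refl)
  (simplify (H (3 + n)) (state 6 3 5 8 (3 + n)) (state 6 3 5 6 (3 + n)))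
  where
  simplify : ∀ a c d → 1P *P a -P (0P -P X) *P [] +P 0P *P c -P 0P *P d ≈ a
  simplify = solve-∀ Poly-ring

G-step : ∀ n → G (4 + n) ≈ principal 4 (3 + n) -P C (3 + n)
G-step n = ≈-trans (state-expand 3 2 4 5 n ≈-refl (C-column2≈C (3 + n)) ≈-refl ≈-refl)
  (simplify (principal 4 (3 + n)) (C (3 + n)) (state 4 2 4 6 (3 + n)) (state 4 2 4 5 (3 + n)))
  where
  simplify : ∀ a b c d → 1P *P a -P 1P *P b +P 0P *P c -P 0P *P d ≈ a -P b
  simplify = solve-∀ Poly-ring

H-step : ∀ n → H (4 + n) ≈ X *P C (3 + n)
H-step n = ≈-trans (state-expand 3 2 3 5 n ≈-refl (C-column2≈C (3 + n)) ≈-refl ≈-refl)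
  (simplify (C (3 + n)) (state 4 2 3 6 (3 + n)) (state 4 2 3 5 (3 + n)))
  where
  simplify : ∀ a c d → 1P *P a -P (1P -P X) *P a +P 0P *P c -P 0P *P d ≈ X *P a
  simplify = solve-∀ Poly-ring

-- The transfer matrix and Cayley–Hamilton

T₁₁ : Poly
T₁₁ = X *P X *P (1P -P X)

Δ : ℕ → Poly
Δ n = G n -P H n

principal₄-twice : ∀ n → principal 4 (5 + n) ≈ X *P X *P principal 3 (3 + n)
principal₄-twice n = begin
  principal 4 (5 + n)                        ≈⟨ principal₄-step (1 + n) ⟩
  negP X *P principal 5 (4 + n)              ≈⟨ *P-congˡ (negP X) (principal₅-step n) ⟩
  negP X *P (negP X *P principal 3 (3 + n))  ≈⟨ simplify X (principal 3 (3 + n)) ⟩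
  X *P X *P principal 3 (3 + n)              ∎
  where
  open ≈-Reasoning
  simplify : ∀ x a → negP x *P (negP x *P a) ≈ x *P x *P a
  simplify = solve-∀ Poly-ring

C-twice : ∀ n → C (5 + n) ≈ Δ (3 + n)
C-twice n = ≈-trans (C-step (1 + n)) (+P-cong (E-step n) (negP-cong (F-step n)))

transfer-principal : ∀ n → principal 3 (7 + n) ≈ T₁₁ *P principal 3 (4 + n) -P Δ (4 + n)
transfer-principal n = begin
  principal 3 (7 + n)
    ≈⟨ principal₃-step (3 + n) ⟩
  (1P -P X) *P principal 4 (6 + n) -P C (6 + n)
    ≈⟨ +P-cong (*P-congˡ (1P -P X) (principal₄-twice (1 + n))) (negP-cong (C-twice (1 + n))) ⟩
  (1P -P X) *P (X *P X *P principal 3 (4 + n)) -P Δ (4 + n)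
    ≈⟨ simplify X (principal 3 (4 + n)) (Δ (4 + n)) ⟩
  T₁₁ *P principal 3 (4 + n) -P Δ (4 + n)
    ∎
  where
  open ≈-Reasoning
  simplify : ∀ x a b → (1P -P x) *P (x *P x *P a) -P b ≈ x *P x *P (1P -P x) *P a -P b
  simplify = solve-∀ Poly-ring

transfer-Δ : ∀ n → Δ (7 + n) ≈ X *P X *P principal 3 (4 + n) -P (1P +P X) *P Δ (4 + n)
transfer-Δ n = begin
  G (7 + n) -P H (7 + n)
    ≈⟨ +P-cong (G-step (3 + n)) (negP-cong (H-step (3 + n))) ⟩
  principal 4 (6 + n) -P C (6 + n) -P X *P C (6 + n)
    ≈⟨ +P-cong (+P-cong (principal₄-twice (1 + n)) (negP-cong (C-twice (1 + n))))
               (negP-cong (*P-congˡ X (C-twice (1 + n)))) ⟩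
  X *P X *P principal 3 (4 + n) -P Δ (4 + n) -P X *P Δ (4 + n)
    ≈⟨ simplify X (principal 3 (4 + n)) (Δ (4 + n)) ⟩
  X *P X *P principal 3 (4 + n) -P (1P +P X) *P Δ (4 + n)
    ∎
  where
  open ≈-Reasoning
  simplify : ∀ x a b → x *P x *P a -P b -P x *P b ≈ x *P x *P a -P (1P +P x) *P b
  simplify = solve-∀ Poly-ring

-- The first component of T² (α, δ) = tr T · T (α, δ) − det T · (α, δ).
cayley-hamilton : ∀ x α δ →
  x *P x *P (1P -P x) *P (x *P x *P (1P -P x) *P α -P δ) -P (x *P x *P α -P (1P +P x) *P δ) ≈
  (x *P x *P (1P -P x) -P (1P +P x)) *P (x *P x *P (1P -P x) *P α -P δ) -P x *P x *P x *P x *P α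
cayley-hamilton = solve-∀ Poly-ring

principal-recurrence : ∀ n →
  principal 3 (10 + n) ≈ c₁ *P principal 3 (7 + n) -P x⁴ *P principal 3 (4 + n)
principal-recurrence n = begin
  principal 3 (10 + n)
    ≈⟨ transfer-principal (3 + n) ⟩
  T₁₁ *P principal 3 (7 + n) -P Δ (7 + n)
    ≈⟨ +P-cong (*P-congˡ T₁₁ (transfer-principal n)) (negP-cong (transfer-Δ n)) ⟩
  T₁₁ *P (T₁₁ *P α -P δ) -P (X *P X *P α -P (1P +P X) *P δ)
    ≈⟨ cayley-hamilton X α δ ⟩
  (T₁₁ -P (1P +P X)) *P (T₁₁ *P α -P δ) -P X *P X *P X *P X *P α
    ≈⟨ +P-cong (*P-cong trace≈c₁ (≈-sym (transfer-principal n)))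
               (negP-cong (*P-cong det≈x⁴ ≈-refl)) ⟩
  c₁ *P principal 3 (7 + n) -P x⁴ *P α
    ∎
  where
  open ≈-Reasoning
  α δ : Poly
  α = principal 3 (4 + n)
  δ = Δ (4 + n)
  trace≈c₁ : T₁₁ -P (1P +P X) ≈ c₁
  trace≈c₁ = ≈-decide _ _
  det≈x⁴ : X *P X *P X *P X ≈ x⁴
  det≈x⁴ = ≈-decide _ _

opaque
  unfolding state

  principal₃-4≈a₁ : principal 3 4 ≈ a 1
  principal₃-4≈a₁ = ≈-decide _ _

  initial-transfer≈a₂ : T₁₁ *P principal 3 4 -P Δ 4 ≈ a 2
  initial-transfer≈a₂ = ≈-decide _ _

  charPoly≈principal : ∀ m → charPoly m ≈ principal 3 (suc (3 * m))
  charPoly≈principal m = det-cong (suc (3 * m)) λ r c → ≈-reflexive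
    (trans (charMatrix≡entry m r c) (cong (entry (3 + toℕ r)) (sym (column-principal (toℕ c)))))
    where
    column-principal : ∀ c → column 3 3 4 5 c ≡ 3 + c
    column-principal 0                   = refl
    column-principal 1                   = refl
    column-principal 2                   = refl
    column-principal (suc (suc (suc c))) = refl

principal≈a : ∀ k → principal 3 (4 + k * 3) ≈ a (suc k)
principal≈a 0             = principal₃-4≈a₁
principal≈a 1             = ≈-trans (transfer-principal 0) initial-transfer≈a₂
principal≈a (suc (suc k)) = ≈-trans (principal-recurrence (k * 3))
  (+P-cong (*P-congˡ c₁ (principal≈a (suc k))) (negP-cong (*P-congˡ x⁴ (principal≈a k))))

charPoly≈a : ∀ m → charPoly m ≈ a m
charPoly≈a zero    = ≈-decide _ _
charPoly≈a (suc k) = begin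
  charPoly (suc k)              ≈⟨ charPoly≈principal (suc k) ⟩
  principal 3 (suc (3 * suc k)) ≡⟨ cong (λ w → principal 3 (suc w)) (*-comm 3 (suc k)) ⟩
  principal 3 (4 + k * 3)       ≈⟨ principal≈a k ⟩
  a (suc k)                     ∎
  where open ≈-Reasoning

lemma2p3 : (m : ℕ) → charPoly m ≈P a m
lemma2p3 m = coeff-≡ (charPoly≈a m)
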